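{- Let $t$, $u_1,\dots,u_k$ be $\lambda$-terms and $x$ a variable. If $(t\ u_1\ \dots\ u_k) \in SN$ then $(\lambda x.t\ \ x\ u_1\ \dots\ u_k) \in SN$.
   Context: $\lambda$-terms: $\mathcal{M} ::= x \mid \lambda x.\mathcal{M} \mid (\mathcal{M}\ \mathcal{M})$, up to $\alpha$-conversion, application associating to the left (so $(\lambda x.t\ \ x\ u_1\dots u_k)$ is the abstraction $\lambda x.t$ applied successively to $x,u_1,\dots,u_k$). Rules (applied to any subterm): $\beta$: $(\lambda x.M\ N) \triangleright M[x:=N]$; $\delta$: $(\lambda y.\lambda x.M\ N) \triangleright \lambda x.(\lambda y.M\ N)$ with $x$ not free in $N$; $\gamma$: $(\lambda x.M\ N\ P) \triangleright (\lambda x.(M\ P)\ N)$ with $x$ not free in $P$; $assoc$: $(M\ (\lambda x.N\ P)) \triangleright (\lambda x.(M\ N)\ P)$ with $x$ not free in $M$. $SN$ is the set of terms strongly normalizing for the union of these four rules. -}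

module Defs where

open import Data.Nat using (ℕ; zero; suc; _≟_)
open import Data.List using (List; []; _∷_; foldl)
open import Relation.Nullary using (yes; no)

-- λ-terms with de Bruijn indices (this quotients by α-conversion).
data Term : Set where
  var : ℕ → Term
  lam : Term → Term
  app : Term → Term → Term

ext : (ℕ → ℕ) → ℕ → ℕ
ext ρ zero    = zero
ext ρ (suc n) = suc (ρ n)

rename : (ℕ → ℕ) → Term → Term
rename ρ (var n)   = var (ρ n)
rename ρ (lam t)   = lam (rename (ext ρ) t)
rename ρ (app t u) = app (rename ρ t) (rename ρ u)

↑ : Term → Term
↑ = rename suc

swap01 : ℕ → ℕ
swap01 zero          = suc zero
swap01 (suc zero)    = zero
swap01 (suc (suc n)) = suc (suc n)

exts : (ℕ → Term) → ℕ → Term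
exts σ zero    = var zero
exts σ (suc n) = ↑ (σ n)

subst : (ℕ → Term) → Term → Term
subst σ (var n)   = σ n
subst σ (lam t)   = lam (subst (exts σ) t)
subst σ (app t u) = app (subst σ t) (subst σ u)

sub0 : Term → ℕ → Term
sub0 N zero    = N
sub0 N (suc n) = var n

_[_] : Term → Term → Term
M [ N ] = subst (sub0 N) M

-- Named abstraction λx.t : bind the free variable x of t.
close : ℕ → ℕ → ℕ
close x y with y ≟ x
... | yes _ = zero
... | no  _ = suc y

ƛ_∙_ : ℕ → Term → Term
ƛ x ∙ t = lam (rename (close x) t)

apps : Term → List Term → Term
apps t us = foldl app t us

-- Root rules.  The "x not free in N / P / M" side conditions are
-- automatic in de Bruijn form (the term is shifted under the binder).
data _▷_ : Term → Term → Set where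
  β     : ∀ {M N} → app (lam M) N ▷ (M [ N ])
  -- (λy.λx.M N) ▷ λx.(λy.M N);  y = index 1, x = index 0 in M
  δ     : ∀ {M N} → app (lam (lam M)) N ▷ lam (app (lam (rename swap01 M)) (↑ N))
  -- (λx.M N P) ▷ (λx.(M P) N)
  γ     : ∀ {M N P} → app (app (lam M) N) P ▷ app (lam (app M (↑ P))) N
  -- (M (λx.N P)) ▷ (λx.(M N) P)
  assoc : ∀ {M N P} → app M (app (lam N) P) ▷ app (lam (app (↑ M) N)) P

data _⟶_ : Term → Term → Set where
  root : ∀ {M N} → M ▷ N → M ⟶ N
  ξλ   : ∀ {M N} → M ⟶ N → lam M ⟶ lam N
  ξ₁   : ∀ {M N P} → M ⟶ N → app M P ⟶ app N P
  ξ₂   : ∀ {M N P} → M ⟶ N → app P M ⟶ app P N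

data SN (t : Term) : Set where
  sn : (∀ {t'} → t ⟶ t' → SN t') → SN t

module Submission where

open import Defs
open import Data.Nat using (ℕ; zero; suc; _+_; _*_; _≤_; _<_; z≤n; s≤s; _≟_; NonZero; >-nonZero)
open import Data.Nat.Properties
open import Data.Nat.Induction using (<-wellFounded)
open import Data.List using (List; []; _∷_)
open import Data.Product using (∃-syntax; _×_; _,_)
open import Induction.WellFounded using (Acc; acc)
open import Relation.Nullary using (yes; no)
open import Relation.Binary.PropositionalEquality
  using (_≡_; refl; sym; trans; cong; cong₂)
  renaming (subst to transport)

-- Write d ⊢ A ⊒ B when A is obtained from B by re-expanding some contracta
-- M[n] into redexes (λ.M n) whose argument n is a variable free at binder
-- depth d (n ≥ d).  A step of A is either mirrored by a step of B, or it is
-- a "silent" step that only contracts or shuffles such an expanded redex and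
-- keeps the same B; silent steps strictly decrease a multiplicative weight μ
-- in which an expanded redex weighs one less than the product of its parts.
-- A nested induction on SN B and on μ A then gives SN A, and the theorem is
-- the instance A = (λx.t x) u⃗, B = t u⃗.

ext-cong : ∀ {ρ ρ'} → (∀ n → ρ n ≡ ρ' n) → ∀ n → ext ρ n ≡ ext ρ' n
ext-cong h zero    = refl
ext-cong h (suc n) = cong suc (h n)

rename-cong : ∀ {ρ ρ'} → (∀ n → ρ n ≡ ρ' n) → ∀ t → rename ρ t ≡ rename ρ' t
rename-cong h (var n)   = cong var (h n)
rename-cong h (lam t)   = cong lam (rename-cong (ext-cong h) t)
rename-cong h (app t u) = cong₂ app (rename-cong h t) (rename-cong h u)

exts-cong : ∀ {σ σ'} → (∀ n → σ n ≡ σ' n) → ∀ n → exts σ n ≡ exts σ' n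
exts-cong h zero    = refl
exts-cong h (suc n) = cong ↑ (h n)

subst-cong : ∀ {σ σ'} → (∀ n → σ n ≡ σ' n) → ∀ t → subst σ t ≡ subst σ' t
subst-cong h (var n)   = h n
subst-cong h (lam t)   = cong lam (subst-cong (exts-cong h) t)
subst-cong h (app t u) = cong₂ app (subst-cong h t) (subst-cong h u)

rename-rename : ∀ ρ ρ' t → rename ρ (rename ρ' t) ≡ rename (λ n → ρ (ρ' n)) t
rename-rename ρ ρ' (var n)   = refl
rename-rename ρ ρ' (lam t)   = cong lam (trans (rename-rename (ext ρ) (ext ρ') t)
  (rename-cong (λ { zero → refl ; (suc n) → refl }) t))
rename-rename ρ ρ' (app t u) = cong₂ app (rename-rename ρ ρ' t) (rename-rename ρ ρ' u)

subst-rename : ∀ σ ρ t → subst σ (rename ρ t) ≡ subst (λ n → σ (ρ n)) t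
subst-rename σ ρ (var n)   = refl
subst-rename σ ρ (lam t)   = cong lam (trans (subst-rename (exts σ) (ext ρ) t)
  (subst-cong (λ { zero → refl ; (suc n) → refl }) t))
subst-rename σ ρ (app t u) = cong₂ app (subst-rename σ ρ t) (subst-rename σ ρ u)

rename-subst : ∀ ρ σ t → rename ρ (subst σ t) ≡ subst (λ n → rename ρ (σ n)) t
rename-subst ρ σ (var n)   = refl
rename-subst ρ σ (lam t)   = cong lam (trans (rename-subst (ext ρ) (exts σ) t) (subst-cong exts-comm t))
  where
  exts-comm : ∀ n → rename (ext ρ) (exts σ n) ≡ exts (λ k → rename ρ (σ k)) n
  exts-comm zero    = refl
  exts-comm (suc n) = trans (rename-rename (ext ρ) suc (σ n)) (sym (rename-rename suc ρ (σ n)))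
rename-subst ρ σ (app t u) = cong₂ app (rename-subst ρ σ t) (rename-subst ρ σ u)

subst-subst : ∀ τ σ t → subst τ (subst σ t) ≡ subst (λ n → subst τ (σ n)) t
subst-subst τ σ (var n)   = refl
subst-subst τ σ (lam t)   = cong lam (trans (subst-subst (exts τ) (exts σ) t) (subst-cong exts-comm t))
  where
  exts-comm : ∀ n → subst (exts τ) (exts σ n) ≡ exts (λ k → subst τ (σ k)) n
  exts-comm zero    = refl
  exts-comm (suc n) = trans (subst-rename (exts τ) suc (σ n)) (sym (rename-subst suc τ (σ n)))
subst-subst τ σ (app t u) = cong₂ app (subst-subst τ σ t) (subst-subst τ σ u)

subst-var : ∀ t → subst var t ≡ t
subst-var (var n)   = refl
subst-var (lam t)   = cong lam (trans (subst-cong (λ { zero → refl ; (suc n) → refl }) t) (subst-var t))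
subst-var (app t u) = cong₂ app (subst-var t) (subst-var u)

subst-renaming : ∀ {σ ρ} → (∀ n → σ n ≡ var (ρ n)) → ∀ t → subst σ t ≡ rename ρ t
subst-renaming h (var n)   = h n
subst-renaming h (lam t)   = cong lam (subst-renaming (λ { zero → refl ; (suc n) → cong ↑ (h n) }) t)
subst-renaming h (app t u) = cong₂ app (subst-renaming h t) (subst-renaming h u)

subst-↑ : ∀ σ t → subst (exts σ) (↑ t) ≡ ↑ (subst σ t)
subst-↑ σ t = trans (subst-rename (exts σ) suc t) (sym (rename-subst suc σ t))

subst-swap01 : ∀ σ t →
  subst (exts (exts σ)) (rename swap01 t) ≡ rename swap01 (subst (exts (exts σ)) t)
subst-swap01 σ t = trans (subst-rename _ swap01 t)
  (trans (subst-cong exts²-swap01 t) (sym (rename-subst swap01 (exts (exts σ)) t)))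
  where
  exts²-swap01 : ∀ n → exts (exts σ) (swap01 n) ≡ rename swap01 (exts (exts σ) n)
  exts²-swap01 zero          = refl
  exts²-swap01 (suc zero)    = refl
  exts²-swap01 (suc (suc n)) = trans (rename-rename suc suc (σ n))
    (sym (trans (rename-rename swap01 suc (↑ (σ n))) (rename-rename (λ k → swap01 (suc k)) suc (σ n))))

subst-[] : ∀ σ M N → subst σ (M [ N ]) ≡ subst (exts σ) M [ subst σ N ]
subst-[] σ M N = trans (subst-subst σ (sub0 N) M)
  (trans (subst-cong sub0-comm M) (sym (subst-subst (sub0 (subst σ N)) (exts σ) M)))
  where
  sub0-comm : ∀ n → subst σ (sub0 N n) ≡ subst (sub0 (subst σ N)) (exts σ n)
  sub0-comm zero    = refl
  sub0-comm (suc n) = sym (trans (subst-rename (sub0 (subst σ N)) suc (σ n)) (subst-var (σ n)))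

rename-[] : ∀ ρ M N → rename ρ (M [ N ]) ≡ rename (ext ρ) M [ rename ρ N ]
rename-[] ρ M N = trans (rename-subst ρ (sub0 N) M)
  (trans (subst-cong (λ { zero → refl ; (suc n) → refl }) M)
         (sym (subst-rename (sub0 (rename ρ N)) (ext ρ) M)))

↑-[] : ∀ M N → ↑ M [ N ] ≡ M
↑-[] M N = trans (subst-rename (sub0 N) suc M) (subst-var M)

swap01-[] : ∀ n M → rename swap01 M [ var (suc n) ] ≡ subst (exts (sub0 (var n))) M
swap01-[] n M = trans (subst-rename _ swap01 M)
  (subst-cong (λ { zero → refl ; (suc zero) → refl ; (suc (suc k)) → refl }) M)

close-[] : ∀ x t → rename (close x) t [ var x ] ≡ t
close-[] x t = trans (subst-rename (sub0 (var x)) (close x) t) (trans (subst-cong reopen t) (subst-var t))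
  where
  reopen : ∀ y → sub0 (var x) (close x y) ≡ var y
  reopen y with y ≟ x
  ... | yes y≡x = cong var (sym y≡x)
  ... | no  _   = refl

subst-⟶ : ∀ σ {M N} → M ⟶ N → subst σ M ⟶ subst σ N
subst-⟶ σ (root (β {M} {N})) =
  transport (subst σ (app (lam M) N) ⟶_) (sym (subst-[] σ M N)) (root β)
subst-⟶ σ (root (δ {M} {N})) =
  transport (subst σ (app (lam (lam M)) N) ⟶_)
    (sym (cong₂ (λ a b → lam (app (lam a) b)) (subst-swap01 σ M) (subst-↑ σ N))) (root δ)
subst-⟶ σ (root (γ {M} {N} {P})) =
  transport (subst σ (app (app (lam M) N) P) ⟶_)
    (sym (cong (λ b → app (lam (app (subst (exts σ) M) b)) (subst σ N)) (subst-↑ σ P))) (root γ)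
subst-⟶ σ (root (assoc {M} {N} {P})) =
  transport (subst σ (app M (app (lam N) P)) ⟶_)
    (sym (cong (λ b → app (lam (app b (subst (exts σ) N))) (subst σ P)) (subst-↑ σ M))) (root assoc)
subst-⟶ σ (ξλ s) = ξλ (subst-⟶ (exts σ) s)
subst-⟶ σ (ξ₁ s) = ξ₁ (subst-⟶ σ s)
subst-⟶ σ (ξ₂ s) = ξ₂ (subst-⟶ σ s)

infix 4 _⊢_⊒_

data _⊢_⊒_ : ℕ → Term → Term → Set where
  var    : ∀ {d n} → d ⊢ var n ⊒ var n
  lam    : ∀ {d M M'} → suc d ⊢ M ⊒ M' → d ⊢ lam M ⊒ lam M'
  app    : ∀ {d M M' N N'} → d ⊢ M ⊒ M' → d ⊢ N ⊒ N' → d ⊢ app M N ⊒ app M' N'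
  expand : ∀ {d M M' n} → suc d ⊢ M ⊒ M' → d ≤ n → d ⊢ app (lam M) (var n) ⊒ (M' [ var n ])

⊒-refl : ∀ {d} t → d ⊢ t ⊒ t
⊒-refl (var n)   = var
⊒-refl (lam t)   = lam (⊒-refl t)
⊒-refl (app t u) = app (⊒-refl t) (⊒-refl u)

⊒-apps : ∀ {d A B} us → d ⊢ A ⊒ B → d ⊢ apps A us ⊒ apps B us
⊒-apps []       r = r
⊒-apps (u ∷ us) r = ⊒-apps us (app r (⊒-refl u))

FreeRenaming : ℕ → ℕ → (ℕ → ℕ) → Set
FreeRenaming d d' ρ = ∀ n → d ≤ n → d' ≤ ρ n

freeRenaming-ext : ∀ {d d' ρ} → FreeRenaming d d' ρ → FreeRenaming (suc d) (suc d') (ext ρ)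
freeRenaming-ext f (suc n) (s≤s d≤n) = s≤s (f n d≤n)

freeRenaming-suc : ∀ {d} → FreeRenaming d (suc d) suc
freeRenaming-suc n d≤n = s≤s d≤n

freeRenaming-swap01 : ∀ {d} → FreeRenaming (suc (suc d)) (suc (suc d)) swap01
freeRenaming-swap01 (suc zero)    (s≤s ())
freeRenaming-swap01 (suc (suc n)) d≤n = d≤n

⊒-rename : ∀ {d d' ρ A B} → FreeRenaming d d' ρ → d ⊢ A ⊒ B → d' ⊢ rename ρ A ⊒ rename ρ B
⊒-rename f var         = var
⊒-rename f (lam r)     = lam (⊒-rename (freeRenaming-ext f) r)
⊒-rename f (app r r')  = app (⊒-rename f r) (⊒-rename f r')
⊒-rename {d' = d'} {ρ} f (expand {M' = M'} {n} r d≤n) =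
  transport (d' ⊢ _ ⊒_) (sym (rename-[] ρ M' (var n)))
    (expand (⊒-rename (freeRenaming-ext f) r) (f n d≤n))

-- Free variables must stay variables: they are the arguments of expanded redexes.
record FreeSubst (d d' : ℕ) (σ σ' : ℕ → Term) : Set where
  field
    ⊒-pointwise : ∀ n → d' ⊢ σ n ⊒ σ' n
    free↦free   : ∀ n → d ≤ n → ∃[ m ] σ n ≡ var m × σ' n ≡ var m × d' ≤ m
open FreeSubst

freeSubst-exts : ∀ {d d' σ σ'} → FreeSubst d d' σ σ' → FreeSubst (suc d) (suc d') (exts σ) (exts σ')
freeSubst-exts f .⊒-pointwise zero    = var
freeSubst-exts f .⊒-pointwise (suc n) = ⊒-rename freeRenaming-suc (⊒-pointwise f n)
freeSubst-exts f .free↦free (suc n) (s≤s d≤n) with free↦free f n d≤n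
... | m , σn≡m , σ'n≡m , d'≤m = suc m , cong ↑ σn≡m , cong ↑ σ'n≡m , s≤s d'≤m

freeSubst-sub0 : ∀ {d N N'} → d ⊢ N ⊒ N' → FreeSubst (suc d) d (sub0 N) (sub0 N')
freeSubst-sub0 r .⊒-pointwise zero    = r
freeSubst-sub0 r .⊒-pointwise (suc n) = var
freeSubst-sub0 r .free↦free (suc n) (s≤s d≤n) = n , refl , refl , d≤n

⊒-subst : ∀ {d d' σ σ' A B} → FreeSubst d d' σ σ' → d ⊢ A ⊒ B → d' ⊢ subst σ A ⊒ subst σ' B
⊒-subst f (var {n = n}) = ⊒-pointwise f n
⊒-subst f (lam r)       = lam (⊒-subst (freeSubst-exts f) r)
⊒-subst f (app r r')    = app (⊒-subst f r) (⊒-subst f r')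
⊒-subst {σ' = σ'} f (expand {M' = M'} {n} r d≤n) with free↦free f n d≤n
... | m , σn≡m , σ'n≡m , d'≤m rewrite subst-[] σ' M' (var n) | σn≡m | σ'n≡m =
  expand (⊒-subst (freeSubst-exts f) r) d'≤m

-- The argument is matched first so that μ (app t u) computes to μ t * μ u
-- whenever u is not a variable, whatever t is.
mutual
  μ : Term → ℕ
  μ (var n)         = 2
  μ (lam t)         = suc (μ t)
  μ (app t (var n)) = μ-applied-to-var t
  μ (app t u)       = μ t * μ u

  μ-applied-to-var : Term → ℕ
  μ-applied-to-var (lam t) = suc (μ t + μ t)
  μ-applied-to-var t       = μ t * 2

μ-rename : ∀ ρ t → μ (rename ρ t) ≡ μ t
μ-rename ρ (var n)                 = refl
μ-rename ρ (lam t)                 = cong suc (μ-rename (ext ρ) t)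
μ-rename ρ (app (lam t) (var n))   = cong (λ k → suc (k + k)) (μ-rename (ext ρ) t)
μ-rename ρ (app (var m) (var n))   = refl
μ-rename ρ (app (app t u) (var n)) = cong (_* 2) (μ-rename ρ (app t u))
μ-rename ρ (app t (lam u))         = cong₂ _*_ (μ-rename ρ t) (μ-rename ρ (lam u))
μ-rename ρ (app t (app u v))       = cong₂ _*_ (μ-rename ρ t) (μ-rename ρ (app u v))

μ-[var] : ∀ n M → μ (M [ var n ]) ≡ μ M
μ-[var] n M = trans (cong μ (subst-renaming {ρ = λ { zero → n ; (suc k) → k }}
                              (λ { zero → refl ; (suc k) → refl }) M))
                    (μ-rename _ M)

2≤* : ∀ {a b} → 2 ≤ a → 2 ≤ b → 2 ≤ a * b
2≤* 2≤a 2≤b = ≤-trans (s≤s (s≤s z≤n)) (*-mono-≤ 2≤a 2≤b)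

2≤μ : ∀ t → 2 ≤ μ t
2≤μ (var n)                 = ≤-refl
2≤μ (lam t)                 = m≤n⇒m≤1+n (2≤μ t)
2≤μ (app (lam t) (var n))   = s≤s (≤-trans (≤-trans (n≤1+n 1) (2≤μ t)) (m≤m+n (μ t) (μ t)))
2≤μ (app (var m) (var n))   = 2≤* ≤-refl ≤-refl
2≤μ (app (app t u) (var n)) = 2≤* (2≤μ (app t u)) ≤-refl
2≤μ (app t (lam u))         = 2≤* (2≤μ t) (2≤μ (lam u))
2≤μ (app t (app u v))       = 2≤* (2≤μ t) (2≤μ (app u v))

μ-nonZero : ∀ t → NonZero (μ t)
μ-nonZero t = >-nonZero (≤-trans (s≤s z≤n) (2≤μ t))

μ-app≤ : ∀ t u → μ (app t u) ≤ μ t * μ u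
μ-app≤ (lam t) (var n)   = s≤s (≤-trans (≤-reflexive (trans (cong (μ t +_) (sym (+-identityʳ (μ t))))
                                                               (*-comm 2 (μ t))))
                                        (n≤1+n _))
μ-app≤ (var m) (var n)   = ≤-refl
μ-app≤ (app t u) (var n) = ≤-refl
μ-app≤ t (lam u)         = ≤-refl
μ-app≤ t (app u v)       = ≤-refl

μ-app-app : ∀ t u v → μ (app (app t u) v) ≡ μ (app t u) * μ v
μ-app-app t u (var n)   = refl
μ-app-app t u (lam v)   = refl
μ-app-app t u (app v w) = refl

μ-ξ₁ : ∀ {M M'} N → M ⟶ M' → μ M' < μ M → μ (app M' N) < μ (app M N)
μ-ξ₁ {lam t} (var n) (ξλ s)    lt = s≤s (+-mono-< (≤-pred lt) (≤-pred lt))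
μ-ξ₁ {lam t} (var n) (root ()) lt
μ-ξ₁ {var m} N (root ()) lt
μ-ξ₁ {app _ _} {M'} (var n) s lt = ≤-<-trans (μ-app≤ M' (var n)) (*-monoˡ-< 2 lt)
μ-ξ₁ {M' = M'} (lam u)   s lt = ≤-<-trans (μ-app≤ M' (lam u)) (*-monoˡ-< _ {{μ-nonZero (lam u)}} lt)
μ-ξ₁ {M' = M'} (app u v) s lt = ≤-<-trans (μ-app≤ M' (app u v)) (*-monoˡ-< _ {{μ-nonZero (app u v)}} lt)

μ-ξ₂ : ∀ M {N N'} → N ⟶ N' → μ N' < μ N → μ (app M N') < μ (app M N)
μ-ξ₂ M {lam u}   {N'} s lt = ≤-<-trans (μ-app≤ M N') (*-monoʳ-< _ {{μ-nonZero M}} lt)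
μ-ξ₂ M {app u v} {N'} s lt = ≤-<-trans (μ-app≤ M N') (*-monoʳ-< _ {{μ-nonZero M}} lt)
μ-ξ₂ M {var n}   (root ()) lt

μ-β-var : ∀ M n → μ (M [ var n ]) < μ (app (lam M) (var n))
μ-β-var M n = s≤s (≤-trans (≤-reflexive (μ-[var] n M)) (m≤m+n (μ M) (μ M)))

μ-δ-var : ∀ M n → μ (lam (app (lam (rename swap01 M)) (var (suc n)))) < μ (app (lam (lam M)) (var n))
μ-δ-var M n = s≤s (s≤s (≤-reflexive (trans (cong (λ k → suc (k + k)) (μ-rename swap01 M))
                                           (sym (+-suc (μ M) (μ M))))))

μ-γ-var : ∀ M P n → μ (app (lam (app M (↑ P))) (var n)) < μ (app (app (lam M) (var n)) P)
μ-γ-var M P n = begin-strict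
  suc (k + k)                 <⟨ +-mono-≤ (2≤μ P) (+-mono-≤ k≤ k≤) ⟩
  μ P + (μ M * μ P + μ M * μ P) ≡⟨ cong (μ P +_) (sym (*-distribʳ-+ (μ P) (μ M) (μ M))) ⟩
  suc (μ M + μ M) * μ P        ≡⟨ sym (μ-app-app (lam M) (var n) P) ⟩
  μ (app (app (lam M) (var n)) P) ∎
  where
  open ≤-Reasoning
  k = μ (app M (↑ P))
  k≤ : k ≤ μ M * μ P
  k≤ = ≤-trans (μ-app≤ M (↑ P)) (≤-reflexive (cong (μ M *_) (μ-rename suc P)))

μ-assoc-var : ∀ M N n → μ (app (lam (app (↑ M) N)) (var n)) < μ (app M (app (lam N) (var n)))
μ-assoc-var M N n = begin-strict
  suc (k + k)                   <⟨ +-mono-≤ (2≤μ M) (+-mono-≤ k≤ k≤) ⟩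
  μ M + (μ M * μ N + μ M * μ N) ≡⟨ cong (μ M +_) (sym (*-distribˡ-+ (μ M) (μ N) (μ N))) ⟩
  μ M + μ M * (μ N + μ N)       ≡⟨ sym (*-suc (μ M) (μ N + μ N)) ⟩
  μ M * suc (μ N + μ N)         ∎
  where
  open ≤-Reasoning
  k = μ (app (↑ M) N)
  k≤ : k ≤ μ M * μ N
  k≤ = ≤-trans (μ-app≤ (↑ M) N) (≤-reflexive (cong (_* μ N) (μ-rename suc M)))

data Simulated (d : ℕ) (A B A' : Term) : Set where
  matched : ∀ {B'} → B ⟶ B' → d ⊢ A' ⊒ B' → Simulated d A B A'
  silent  : d ⊢ A' ⊒ B → μ A' < μ A → Simulated d A B A'

simulate : ∀ {d A B A'} → d ⊢ A ⊒ B → A ⟶ A' → Simulated d A B A'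
simulate (app (lam r) r') (root β) = matched (root β) (⊒-subst (freeSubst-sub0 r') r)
simulate (app (lam (lam r)) r') (root δ) =
  matched (root δ) (lam (app (lam (⊒-rename freeRenaming-swap01 r)) (⊒-rename freeRenaming-suc r')))
simulate (app (app (lam r) r') r″) (root γ) =
  matched (root γ) (app (lam (app r (⊒-rename freeRenaming-suc r″))) r')
simulate (app r (app (lam r') r″)) (root assoc) =
  matched (root assoc) (app (lam (app (⊒-rename freeRenaming-suc r) r')) r″)
simulate (expand {M = M} {n = n} r d≤n) (root β) =
  silent (⊒-subst (freeSubst-sub0 var) r) (μ-β-var M n)
simulate {d} (expand {M = lam M} {lam M'} {n} (lam r) d≤n) (root δ) =
  silent (lam (transport (suc d ⊢ _ ⊒_) (swap01-[] n M')
                (expand (⊒-rename freeRenaming-swap01 r) (s≤s d≤n))))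
         (μ-δ-var M n)
simulate {d} (app {N' = P'} (expand {M = M} {M'} {n} r d≤n) r') (root (γ {P = P})) =
  silent (transport (d ⊢ app (lam (app M (↑ P))) (var n) ⊒_) (cong (app (M' [ var n ])) (↑-[] P' (var n)))
            (expand (app r (⊒-rename freeRenaming-suc r')) d≤n))
         (μ-γ-var M P n)
simulate {d} (app {M = X} {X'} r (expand {M = N} {N'} {n} r' d≤n)) (root assoc) =
  silent (transport (d ⊢ app (lam (app (↑ X) N)) (var n) ⊒_) (cong (λ z → app z (N' [ var n ])) (↑-[] X' (var n)))
            (expand (app (⊒-rename freeRenaming-suc r) r') d≤n))
         (μ-assoc-var X N n)
simulate (expand {n = n} r d≤n) (ξ₁ (ξλ s)) with simulate r s
... | matched s' r' = matched (subst-⟶ (sub0 (var n)) s') (expand r' d≤n)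
... | silent r' lt  = silent (expand r' d≤n) (s≤s (+-mono-< lt lt))
simulate (expand r d≤n) (ξ₁ (root ()))
simulate (expand r d≤n) (ξ₂ (root ()))
simulate var (root ())
simulate (lam r) (ξλ s) with simulate r s
... | matched s' r' = matched (ξλ s') (lam r')
... | silent r' lt  = silent (lam r') (s≤s lt)
simulate (app {N = N} r r') (ξ₁ s) with simulate r s
... | matched s' r″ = matched (ξ₁ s') (app r″ r')
... | silent r″ lt  = silent (app r″ r') (μ-ξ₁ N s lt)
simulate (app {M = M} r r') (ξ₂ s) with simulate r' s
... | matched s' r″ = matched (ξ₂ s') (app r r″)
... | silent r″ lt  = silent (app r r″) (μ-ξ₂ M s lt)

SN-⊒-acc : ∀ {B} → (∀ {B'} → B ⟶ B' → ∀ {d A} → d ⊢ A ⊒ B' → SN A) →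
           ∀ {d A} → d ⊢ A ⊒ B → Acc _<_ (μ A) → SN A
SN-⊒-acc sn-succ r (acc rs) = sn step
  where
  step : ∀ {A'} → _ ⟶ A' → SN A'
  step s with simulate r s
  ... | matched sB r' = sn-succ sB r'
  ... | silent r' lt  = SN-⊒-acc sn-succ r' (rs lt)

SN-⊒ : ∀ {d A B} → SN B → d ⊢ A ⊒ B → SN A
SN-⊒ (sn snB) r = SN-⊒-acc (λ sB → SN-⊒ (snB sB)) r (<-wellFounded _)

lemma3 : (t : Term) (x : ℕ) (us : List Term) →
         SN (apps t us) → SN (apps (app (ƛ x ∙ t) (var x)) us)
lemma3 t x us snB = SN-⊒ snB (⊒-apps us expanded)
  where
  expanded : 0 ⊢ app (ƛ x ∙ t) (var x) ⊒ t
  expanded = transport (0 ⊢ app (ƛ x ∙ t) (var x) ⊒_) (close-[] x t) (expand (⊒-refl _) z≤n)
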